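{- Let $G$ be a finite simple bipartite graph of order $2n$ having a perfect matching $M$. Then $M$ is the unique perfect matching of $G$ if and only if there exists a maximum stable set $S$ of $G$ having an accessibility chain.
   Context: For $A\subseteq V(G)$, $N(A)=\{v\in V(G)-A: v \text{ has a neighbor in } A\}$ and $N[A]=A\cup N(A)$. A stable set is a set of pairwise non-adjacent vertices; a maximum stable set is one of maximum cardinality. A set $A$ is a local maximum stable set of $G$ if $A$ is a maximum stable set of the induced subgraph $G[N[A]]$; $\Psi(G)$ is the family of all such sets. For a set $S=\{x_1,\dots,x_k\}$, an accessibility chain for $S$ is an ordering of its elements such that $\{x_1,\dots,x_j\}\in\Psi(G)$ for all $j\in\{1,\dots,k\}$. -}

module Defs where

open import Data.Nat using (ℕ; _≤_; _*_; suc)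
open import Data.Bool using (Bool; true; false; T; not)
open import Data.Fin using (Fin)
open import Data.Fin.Subset using (Subset; _∈_; _∉_; _⊆_; ∣_∣; ⊥; ⁅_⁆; _∪_)
open import Data.List using (List; []; _∷_; take; length)
open import Data.List.Relation.Unary.Unique.Propositional using (Unique)
import Data.List.Membership.Propositional as LM
open import Data.Product using (Σ; ∃; _×_; _,_)
open import Data.Sum using (_⊎_)
open import Relation.Binary.PropositionalEquality using (_≡_; _≢_)
open import Relation.Nullary using (¬_)
open import Function.Bundles using (_⇔_)

record Graph (m : ℕ) : Set where
  field
    adj   : Fin m → Fin m → Bool
    sym   : ∀ u v → adj u v ≡ adj v u
    irrefl : ∀ v → adj v v ≡ false
open Graph public

Adj : ∀ {m} → Graph m → Fin m → Fin m → Set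
Adj G u v = T (adj G u v)

Bipartite : ∀ {m} → Graph m → Set
Bipartite {m} G = Σ (Fin m → Bool) λ c → ∀ u v → Adj G u v → c u ≢ c v

record PerfectMatching {m : ℕ} (G : Graph m) : Set where
  field
    edge     : Fin m → Fin m → Bool
    edge-sym : ∀ u v → edge u v ≡ edge v u
    edge-adj : ∀ u v → T (edge u v) → Adj G u v
    cover    : ∀ v → Σ (Fin m) λ u → T (edge v u) × (∀ w → T (edge v w) → w ≡ u)
open PerfectMatching public

SameMatching : ∀ {m} {G : Graph m} → PerfectMatching G → PerfectMatching G → Set
SameMatching M M' = ∀ u v → edge M u v ≡ edge M' u v

UniquePM : ∀ {m} {G : Graph m} → PerfectMatching G → Set
UniquePM {G = G} M = ∀ (M' : PerfectMatching G) → SameMatching M' M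

Stable : ∀ {m} → Graph m → Subset m → Set
Stable G S = ∀ u v → u ∈ S → v ∈ S → ¬ Adj G u v

MaximumStable : ∀ {m} → Graph m → Subset m → Set
MaximumStable G S = Stable G S × (∀ T → Stable G T → ∣ T ∣ ≤ ∣ S ∣)

InN : ∀ {m} → Graph m → Subset m → Fin m → Set
InN G A v = v ∉ A × ∃ λ u → u ∈ A × Adj G v u

InClosedN : ∀ {m} → Graph m → Subset m → Fin m → Set
InClosedN G A v = v ∈ A ⊎ InN G A v

-- A is a local maximum stable set (A ∈ Ψ(G)): A is a maximum stable set
-- of the induced subgraph G[N[A]].  Stable sets of G[N[A]] are exactly
-- the stable sets of G all of whose vertices lie in N[A].
LocalMaxStable : ∀ {m} → Graph m → Subset m → Set
LocalMaxStable G A =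
  (∀ v → v ∈ A → InClosedN G A v) ×
  Stable G A ×
  (∀ T → (∀ v → v ∈ T → InClosedN G A v) → Stable G T → ∣ T ∣ ≤ ∣ A ∣)

setOf : ∀ {m} → List (Fin m) → Subset m
setOf []       = ⊥
setOf (x ∷ xs) = ⁅ x ⁆ ∪ setOf xs

AccessibilityChain : ∀ {m} → Graph m → Subset m → List (Fin m) → Set
AccessibilityChain G S xs =
  Unique xs ×
  (∀ v → (v ∈ S) ⇔ (v LM.∈ xs)) ×
  (∀ j → 1 ≤ j → j ≤ length xs → LocalMaxStable G (setOf (take j xs)))

HasAccessibilityChain : ∀ {m} → Graph m → Subset m → Set
HasAccessibilityChain {m} G S = ∃ λ (xs : List (Fin m)) → AccessibilityChain G S xs

-- Write p for the partner map of M and call x₁, …, x_k a peeling if no x_j lies in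
-- L ∪ p[L] for L = {x₁, …, x_(j-1)}, and every neighbour of x_j lies in p[L ∪ {x_j}].
-- For a peeling A we get N[A] ⊆ A ∪ p[A], and a stable set meets each pair {a, p a} at
-- most once, so A ∈ Ψ(G). Prefixes of peelings are peelings, so every peeling is an
-- accessibility chain, and a peeling that covers all vertices is a maximum stable set.
--
-- If M is unique, a covering peeling is built greedily. Suppose no uncovered vertex can
-- be appended. Then every uncovered vertex has an uncovered neighbour other than its
-- partner. Following such edges alternately with M closes a cycle, and switching M along
-- it gives a second perfect matching. Conversely, in a bipartite graph every
-- accessibility chain is a peeling: if a neighbour v of x_j escaped, then {p x_j, v} ∪ L
-- would be a stable set in N[L ∪ {x_j}] larger than L ∪ {x_j}. A maximum stable set
-- with a chain is therefore a covering peeling, and along it any perfect matching is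
-- forced to agree with M.

{-# OPTIONS --safe #-}
module Submission where

open import Defs
open import Data.Nat using (ℕ; _*_)
open import Data.Fin.Subset using (Subset)
open import Data.Product using (Σ; _×_)
open import Function.Bundles using (_⇔_)

open import Data.Bool using (Bool; T; not)
import Data.Bool as Bool
open import Data.Bool.Properties using (not-involutive; not-¬; ¬-not; T-≡; ⇔→≡)
open import Data.Fin using (Fin; zero; suc; _≟_; toℕ; fromℕ<)
open import Data.Fin.Properties using (any?; all?; ¬∀⟶∃¬; pigeonhole; toℕ-fromℕ<)
open import Data.Fin.Subset using (⁅_⁆; _∪_; _-_; ∣_∣; _⊆_; ⊥; ⊤; inside; outside)
  renaming (_∈_ to _∈ₛ_; _∉_ to _∉ₛ_)
open import Data.Fin.Subset.Properties
  using (x∈p∧x≢y⇒x∈p-y; p─q⊆p; ⊆-antisym; p⊆q⇒∣p∣≤∣q∣; ∣⊥∣≡0; drop-there; drop-not-there; ∪-identityˡ;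
         x∈⁅x⁆; x∈⁅y⁆⇒x≡y; x∈p∪q⁺; x∈p∪q⁻; ∉⊥; ∈⊤; ∣p∣≡n⇒p≡⊤)
  renaming (_∈?_ to _∈ₛ?_)
open import Data.Vec.Base using (_∷_)
import Data.Vec.Base as Vec
open import Data.List using (List; []; _∷_; _∷ʳ_; take; length; lookup)
open import Data.List.Properties using (take-suc; take-all; length-++-sucʳ; ++-identityʳ)
open import Data.List.Membership.Propositional using (_∈_; _∉_)
open import Data.List.Membership.Propositional.Properties using (∈-++⁺ˡ; ∈-++⁺ʳ; ∈-++⁻)
open import Data.List.Relation.Unary.Any using (here; there)
open import Data.List.Relation.Unary.All using ([]; _∷_)
open import Data.List.Relation.Unary.All.Properties using (All¬⇒¬Any; ¬Any⇒All¬)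
open import Data.List.Relation.Unary.AllPairs using ([]; _∷_)
open import Data.List.Relation.Unary.Unique.Propositional using (Unique)
import Data.List.Relation.Unary.Unique.Propositional.Properties as Unique
open import Data.Nat using (zero; suc; _+_; _≤_; _<_; z≤n; s≤s; 2+)
open import Data.Nat.Properties
  using (≤-refl; ≤-reflexive; <⇒≤; <⇒≱; +-comm; +-suc; +-identityʳ; n<1+n; m≤n⇒∃[o]m+o≡n; module ≤-Reasoning)
open import Data.Nat.GeneralisedArithmetic using (fold; fold-+)
open import Data.Product using (∃; ∃₂; _,_; proj₁; proj₂)
open import Data.Sum using (_⊎_; inj₁; inj₂; [_,_])
open import Data.Empty using (⊥-elim)
open import Function using (_∘_)
open import Function.Bundles using (mk⇔; Equivalence)
open Equivalence using (to; from)
open import Function.Construct.Composition using (_⇔-∘_)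
open import Function.Construct.Symmetry using (⇔-sym)
open import Relation.Nullary using (¬_; Dec; yes; no; contradiction)
open import Relation.Nullary.Decidable
  using (T?; map′; decidable-stable; _×-dec_; _⊎-dec_; ¬?; isYes; toWitness; fromWitness)
open import Relation.Binary.PropositionalEquality as ≡ using (_≡_; _≢_; refl; cong; subst; subst₂; trans)

x∉p-x : ∀ {n} (s : Subset n) x → x ∉ₛ s - x
x∉p-x (_ ∷ s) zero    ()
x∉p-x (_ ∷ s) (suc x) = x∉p-x s x ∘ drop-there

x∉p⇒p-x≡p : ∀ {n x} {s : Subset n} → x ∉ₛ s → s - x ≡ s
x∉p⇒p-x≡p x∉s = ⊆-antisym (p─q⊆p _ _) (λ y∈s → x∈p∧x≢y⇒x∈p-y y∈s λ { refl → x∉s y∈s })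

x∉p⇒∣⁅x⁆∪p∣≡1+∣p∣ : ∀ {n x} (s : Subset n) → x ∉ₛ s → ∣ ⁅ x ⁆ ∪ s ∣ ≡ suc ∣ s ∣
x∉p⇒∣⁅x⁆∪p∣≡1+∣p∣ {x = zero}  (inside  ∷ s) x∉s = contradiction Vec.here x∉s
x∉p⇒∣⁅x⁆∪p∣≡1+∣p∣ {x = zero}  (outside ∷ s) _   = cong (suc ∘ ∣_∣) (∪-identityˡ s)
x∉p⇒∣⁅x⁆∪p∣≡1+∣p∣ {x = suc x} (inside  ∷ s) x∉s = cong suc (x∉p⇒∣⁅x⁆∪p∣≡1+∣p∣ s (drop-not-there x∉s))
x∉p⇒∣⁅x⁆∪p∣≡1+∣p∣ {x = suc x} (outside ∷ s) x∉s = x∉p⇒∣⁅x⁆∪p∣≡1+∣p∣ s (drop-not-there x∉s)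

∣p∣≤1+∣p-x∣ : ∀ {n} (s : Subset n) x → ∣ s ∣ ≤ suc ∣ s - x ∣
∣p∣≤1+∣p-x∣ s x = begin
  ∣ s ∣               ≤⟨ p⊆q⇒∣p∣≤∣q∣ s⊆⁅x⁆∪s-x ⟩
  ∣ ⁅ x ⁆ ∪ (s - x) ∣ ≡⟨ x∉p⇒∣⁅x⁆∪p∣≡1+∣p∣ (s - x) (x∉p-x s x) ⟩
  suc ∣ s - x ∣       ∎
  where
  open ≤-Reasoning
  s⊆⁅x⁆∪s-x : s ⊆ ⁅ x ⁆ ∪ (s - x)
  s⊆⁅x⁆∪s-x {y} y∈s with y ≟ x
  ... | yes refl = x∈p∪q⁺ (inj₁ (x∈⁅x⁆ x))
  ... | no y≢x   = x∈p∪q⁺ (inj₂ (x∈p∧x≢y⇒x∈p-y y∈s y≢x))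

∣p∣≤1+∣p-x-y∣ : ∀ {n} (s : Subset n) x y → (x ∈ₛ s → y ∉ₛ s) → ∣ s ∣ ≤ suc ∣ s - x - y ∣
∣p∣≤1+∣p-x-y∣ s x y x∈s⇒y∉s with x ∈ₛ? s
... | yes x∈s = subst (λ t → ∣ s ∣ ≤ suc ∣ t ∣) (≡.sym (x∉p⇒p-x≡p y∉s-x)) (∣p∣≤1+∣p-x∣ s x)
  where
  y∉s-x : y ∉ₛ s - x
  y∉s-x = x∈s⇒y∉s x∈s ∘ p─q⊆p s ⁅ x ⁆
... | no x∉s  = subst (λ t → ∣ s ∣ ≤ suc ∣ t - y ∣) (≡.sym (x∉p⇒p-x≡p x∉s)) (∣p∣≤1+∣p-x∣ s y)

∈-setOf⁺ : ∀ {m} {v : Fin m} {xs} → v ∈ xs → v ∈ₛ setOf xs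
∈-setOf⁺ {xs = x ∷ _} (here refl)  = x∈p∪q⁺ (inj₁ (x∈⁅x⁆ x))
∈-setOf⁺              (there v∈xs) = x∈p∪q⁺ (inj₂ (∈-setOf⁺ v∈xs))

∈-setOf⁻ : ∀ {m} {v : Fin m} xs → v ∈ₛ setOf xs → v ∈ xs
∈-setOf⁻ []       v∈⊥ = contradiction v∈⊥ ∉⊥
∈-setOf⁻ (x ∷ xs) v∈ with x∈p∪q⁻ ⁅ x ⁆ (setOf xs) v∈
... | inj₁ v∈⁅x⁆ = here (x∈⁅y⁆⇒x≡y x v∈⁅x⁆)
... | inj₂ v∈xs  = there (∈-setOf⁻ xs v∈xs)

∣setOf∣≡length : ∀ {m} {xs : List (Fin m)} → Unique xs → ∣ setOf xs ∣ ≡ length xs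
∣setOf∣≡length {m} {xs = []} [] = ∣⊥∣≡0 m
∣setOf∣≡length {xs = x ∷ xs} (x∉xs ∷ !xs) =
  trans (x∉p⇒∣⁅x⁆∪p∣≡1+∣p∣ (setOf xs) (All¬⇒¬Any x∉xs ∘ ∈-setOf⁻ xs)) (cong suc (∣setOf∣≡length !xs))

module _ {m} {p : Fin m → Fin m} (p-involutive : ∀ v → p (p v) ≡ v) where

  ∣pairFree∣≤length : ∀ L {S : Subset m} → (∀ {v} → v ∈ₛ S → v ∈ L ⊎ p v ∈ L) →
                      (∀ {v} → v ∈ₛ S → p v ∉ₛ S) → ∣ S ∣ ≤ length L
  ∣pairFree∣≤length [] {S} covered _ = begin
    ∣ S ∣     ≤⟨ p⊆q⇒∣p∣≤∣q∣ {q = ⊥} (λ v∈S → ⊥-elim ([ (λ ()) , (λ ()) ] (covered v∈S))) ⟩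
    ∣ ⊥ {m} ∣ ≡⟨ ∣⊥∣≡0 m ⟩
    0         ∎
    where open ≤-Reasoning
  ∣pairFree∣≤length (a ∷ L) {S} covered pairFree = begin
    ∣ S ∣               ≤⟨ ∣p∣≤1+∣p-x-y∣ S a (p a) pairFree ⟩
    suc ∣ S - a - p a ∣ ≤⟨ s≤s (∣pairFree∣≤length L covered′ (λ v∈S′ → pairFree (S′⊆S v∈S′) ∘ S′⊆S)) ⟩
    suc (length L)      ∎
    where
    open ≤-Reasoning
    S′⊆S : S - a - p a ⊆ S
    S′⊆S = p─q⊆p S ⁅ a ⁆ ∘ p─q⊆p (S - a) ⁅ p a ⁆
    covered′ : ∀ {v} → v ∈ₛ S - a - p a → v ∈ L ⊎ p v ∈ L
    covered′ {v} v∈S′ with covered (S′⊆S v∈S′)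
    ... | inj₁ (here refl)  = contradiction (p─q⊆p (S - a) ⁅ p a ⁆ v∈S′) (x∉p-x S a)
    ... | inj₁ (there v∈L)  = inj₁ v∈L
    ... | inj₂ (here pv≡a)  = contradiction (subst (_∈ₛ S - a - p a) v≡pa v∈S′) (x∉p-x (S - a) (p a))
      where
      v≡pa : v ≡ p a
      v≡pa = trans (≡.sym (p-involutive v)) (cong p pv≡a)
    ... | inj₂ (there pv∈L) = inj₂ pv∈L

∈-∷ʳ⁻ : ∀ {A : Set} {v x : A} L → v ∈ L ∷ʳ x → v ∈ L ⊎ v ≡ x
∈-∷ʳ⁻ L v∈ with ∈-++⁻ L v∈
... | inj₁ v∈L        = inj₁ v∈L
... | inj₂ (here v≡x) = inj₂ v≡x

∷ʳ-unique⁺ : ∀ {A : Set} {x : A} {L} → Unique L → x ∉ L → Unique (L ∷ʳ x)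
∷ʳ-unique⁺ !L x∉L = Unique.++⁺ !L ([] ∷ []) λ { (x∈L , here refl) → x∉L x∈L }

∷ʳ-unique⁻ : ∀ {A : Set} {x : A} L → Unique (L ∷ʳ x) → x ∉ L
∷ʳ-unique⁻ (y ∷ L) (y∉ ∷ _)  (here refl) = All¬⇒¬Any y∉ (∈-++⁺ʳ L (here refl))
∷ʳ-unique⁻ (y ∷ L) (_ ∷ !L) (there x∈L) = ∷ʳ-unique⁻ L !L x∈L

length-∷ʳ : ∀ {A : Set} (L : List A) x → length (L ∷ʳ x) ≡ suc (length L)
length-∷ʳ L x = trans (length-++-sucʳ L x []) (cong (suc ∘ length) (++-identityʳ L))

take-∷ʳ : ∀ {A : Set} j (L : List A) x → take j (L ∷ʳ x) ≡ take j L ⊎ take j (L ∷ʳ x) ≡ L ∷ʳ x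
take-∷ʳ 0       L       x = inj₁ refl
take-∷ʳ 1       []      x = inj₂ refl
take-∷ʳ (2+ j)  []      x = inj₂ refl
take-∷ʳ (suc j) (y ∷ L) x with take-∷ʳ j L x
... | inj₁ eq = inj₁ (cong (y ∷_) eq)
... | inj₂ eq = inj₂ (cong (y ∷_) eq)

take-suc-∷ʳ : ∀ {A : Set} (L : List A) {j} → j < length L → ∃ λ x → take (suc j) L ≡ take j L ∷ʳ x
take-suc-∷ʳ L j<len =
  lookup L i , subst (λ j → take (suc j) L ≡ take j L ∷ʳ lookup L i) (toℕ-fromℕ< j<len) (take-suc L i)
  where
  i : Fin (length L)
  i = fromℕ< j<len

fold-preserves : ∀ {A : Set} {P : A → Set} {f : A → A} → (∀ {x} → P x → P (f x)) →
                 ∀ n {x} → P x → P (fold x f n)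
fold-preserves f-preserves zero    Px = Px
fold-preserves {P = P} f-preserves (suc n) Px = f-preserves (fold-preserves {P = P} f-preserves n Px)

periodic-point : ∀ {m} (f : Fin m → Fin m) x → ∃₂ λ i k → fold (fold x f i) f (suc k) ≡ fold x f i
periodic-point {m} f x with pigeonhole (n<1+n m) (λ i → fold x f (toℕ i))
... | i , j , i<j , fᵢ≡fⱼ with m≤n⇒∃[o]m+o≡n i<j
... | k , 1+i+k≡j = toℕ i , k , (begin
  fold (fold x f (toℕ i)) f (suc k) ≡⟨ fold-+ x f (suc k) ⟨
  fold x f (suc k + toℕ i)          ≡⟨ cong (fold x f) k+1+i≡j ⟩
  fold x f (toℕ j)                  ≡⟨ fᵢ≡fⱼ ⟨
  fold x f (toℕ i)                  ∎)
  where
  open ≡.≡-Reasoning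
  k+1+i≡j : suc k + toℕ i ≡ toℕ j
  k+1+i≡j = trans (+-comm (suc k) (toℕ i)) (trans (+-suc (toℕ i) k) 1+i+k≡j)

T-⇔⇒≡ : ∀ {x y} → T x ⇔ T y → x ≡ y
T-⇔⇒≡ Tx⇔Ty = ⇔→≡ (T-≡ ⇔-∘ (Tx⇔Ty ⇔-∘ ⇔-sym T-≡))

module _ {m : ℕ} {G : Graph m} where

  Adj-sym : ∀ {u v} → Adj G u v → Adj G v u
  Adj-sym {u} {v} = subst T (Graph.sym G u v)

  Adj-irrefl : ∀ {v} → ¬ Adj G v v
  Adj-irrefl {v} = subst T (irrefl G v)

  Adj? : ∀ u v → Dec (Adj G u v)
  Adj? u v = T? (adj G u v)

  adjacent⇒opposite-colours : (bip : Bipartite G) → ∀ {u v} → Adj G u v → proj₁ bip v ≡ not (proj₁ bip u)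
  adjacent⇒opposite-colours (c , proper) {u} {v} uv = ¬-not (proper v u (Adj-sym uv))

  common-neighbours-nonadjacent : Bipartite G → ∀ {x u v} → Adj G x u → Adj G x v → ¬ Adj G u v
  common-neighbours-nonadjacent bip@(c , proper) xu xv uv =
    proper _ _ uv (trans (adjacent⇒opposite-colours bip xu) (≡.sym (adjacent⇒opposite-colours bip xv)))

  partner : PerfectMatching G → Fin m → Fin m
  partner M v = proj₁ (cover M v)

  edge⇔partner : (M : PerfectMatching G) → ∀ {u v} → T (edge M u v) ⇔ v ≡ partner M u
  edge⇔partner M {u} {v} = mk⇔ (proj₂ (proj₂ (cover M u)) v) λ { refl → proj₁ (proj₂ (cover M u)) }

  partner-adj : (M : PerfectMatching G) → ∀ v → Adj G v (partner M v)
  partner-adj M v = edge-adj M v _ (from (edge⇔partner M) refl)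

  partner-involutive : (M : PerfectMatching G) → ∀ v → partner M (partner M v) ≡ v
  partner-involutive M v = ≡.sym (to (edge⇔partner M) (subst T (edge-sym M v _) (from (edge⇔partner M) refl)))

  partner-injective : (M : PerfectMatching G) → ∀ {u v} → partner M u ≡ partner M v → u ≡ v
  partner-injective M {u} {v} pu≡pv = begin
    u                       ≡⟨ partner-involutive M u ⟨
    partner M (partner M u) ≡⟨ cong (partner M) pu≡pv ⟩
    partner M (partner M v) ≡⟨ partner-involutive M v ⟩
    v                       ∎
    where open ≡.≡-Reasoning

  samePartner⇒SameMatching : ∀ {M M′ : PerfectMatching G} → (∀ v → partner M v ≡ partner M′ v) → SameMatching M M′
  samePartner⇒SameMatching {M} {M′} same u v = T-⇔⇒≡ (mk⇔
    (λ uv∈M  → from (edge⇔partner M′) (trans (to (edge⇔partner M) uv∈M) (same u)))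
    (λ uv∈M′ → from (edge⇔partner M) (trans (to (edge⇔partner M′) uv∈M′) (≡.sym (same u)))))

  SameMatching⇒samePartner : ∀ {M M′ : PerfectMatching G} → SameMatching M M′ → ∀ v → partner M v ≡ partner M′ v
  SameMatching⇒samePartner {M} {M′} same v =
    to (edge⇔partner M′) (subst T (same v (partner M v)) (from (edge⇔partner M) refl))

  fromInvolution : (q : Fin m → Fin m) → (∀ v → q (q v) ≡ v) → (∀ v → Adj G v (q v)) → PerfectMatching G
  fromInvolution q q-involutive q-adj = record
    { edge     = λ u v → isYes (v ≟ q u)
    ; edge-sym = λ u v → T-⇔⇒≡ (mk⇔ (fromWitness ∘ flipped ∘ toWitness) (fromWitness ∘ flipped ∘ toWitness))
    ; edge-adj = λ u v uv → subst (Adj G u) (≡.sym (toWitness uv)) (q-adj u)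
    ; cover    = λ v → q v , fromWitness refl , λ w → toWitness
    }
    where
    flipped : ∀ {u v} → v ≡ q u → u ≡ q v
    flipped {u} refl = ≡.sym (q-involutive u)

  module AlternatingCycle (bip : Bipartite G) (M : PerfectMatching G)
    {R : Fin m → Set} (R? : ∀ v → Dec (R v)) (R-partner : ∀ {v} → R v → R (partner M v))
    (R-branch : ∀ {v} → R v → ∃ λ w → R w × Adj G v w × w ≢ partner M v) where

    private
      c : Fin m → Bool
      c = proj₁ bip
      p : Fin m → Fin m
      p = partner M

    Branch : Fin m → Fin m → Set
    Branch v w = R w × Adj G v w × w ≢ p v

    branch? : ∀ v → Dec (∃ (Branch v))
    branch? v = any? λ w → R? w ×-dec Adj? v w ×-dec ¬? (w ≟ p v)

    -- The fallback value v is junk; it is only reached outside R.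
    next : Fin m → Fin m
    next v with branch? v
    ... | yes (w , _) = w
    ... | no _        = v

    next-branch : ∀ {v} → R v → Branch v (next v)
    next-branch {v} Rv with branch? v
    ... | yes (_ , v-w) = v-w
    ... | no ∄          = contradiction (R-branch Rv) ∄

    step : Fin m → Fin m
    step v = next (p v)

    step-R : ∀ {v} → R v → R (step v)
    step-R Rv = proj₁ (next-branch (R-partner Rv))

    step-adj : ∀ {v} → R v → Adj G (p v) (step v)
    step-adj Rv = proj₁ (proj₂ (next-branch (R-partner Rv)))

    step-colour : ∀ {v} → R v → c (step v) ≡ c v
    step-colour {v} Rv = begin
      c (step v)      ≡⟨ adjacent⇒opposite-colours bip (step-adj Rv) ⟩
      not (c (p v))   ≡⟨ cong not (adjacent⇒opposite-colours bip (partner-adj M v)) ⟩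
      not (not (c v)) ≡⟨ not-involutive (c v) ⟩
      c v             ∎
      where open ≡.≡-Reasoning

    step-irreflexive : ∀ {v} → R v → step v ≢ v
    step-irreflexive {v} Rv sv≡v =
      proj₂ (proj₂ (next-branch (R-partner Rv))) (trans sv≡v (≡.sym (partner-involutive M v)))

    module _ {w k} (Rw : R w) (w-periodic : fold w step (suc k) ≡ w) where

      -- The colour condition keeps the cycle disjoint from its partners.
      OnCycle : Fin m → Set
      OnCycle x = (R x × c x ≡ c w) × fold x step (suc k) ≡ x

      onCycle? : ∀ x → Dec (OnCycle x)
      onCycle? x = (R? x ×-dec c x Bool.≟ c w) ×-dec (fold x step (suc k) ≟ x)

      back : Fin m → Fin m
      back x = fold x step k

      step-back : ∀ {x} → OnCycle x → step (back x) ≡ x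
      step-back = proj₂

      back-step : ∀ {x} → OnCycle x → back (step x) ≡ x
      back-step {x} x∈C = begin
        fold (step x) step k ≡⟨ fold-+ x step k ⟨
        fold x step (k + 1)  ≡⟨ cong (fold x step) (+-comm k 1) ⟩
        fold x step (suc k)  ≡⟨ proj₂ x∈C ⟩
        x                    ∎
        where open ≡.≡-Reasoning

      step-onCycle : ∀ {x} → OnCycle x → OnCycle (step x)
      step-onCycle x∈C@((Rx , cx≡cw) , _) = (step-R Rx , trans (step-colour Rx) cx≡cw) , cong step (back-step x∈C)

      back-onCycle : ∀ {x} → OnCycle x → OnCycle (back x)
      back-onCycle = fold-preserves {P = OnCycle} step-onCycle k

      partner-offCycle : ∀ {x} → OnCycle x → ¬ OnCycle (p x)
      partner-offCycle {x} ((_ , cx≡cw) , _) ((_ , cpx≡cw) , _) =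
        not-¬ refl (trans (trans cx≡cw (≡.sym cpx≡cw)) (adjacent⇒opposite-colours bip (partner-adj M x)))

      -- On the alternating cycle w, p w, step w, p (step w), … trade the M-edges for the others.
      switch : Fin m → Fin m
      switch x with onCycle? x | onCycle? (p x)
      ... | yes _ | _     = p (back x)
      ... | no _  | yes _ = step (p x)
      ... | no _  | no _  = p x

      switch-onCycle : ∀ {x} → OnCycle x → switch x ≡ p (back x)
      switch-onCycle {x} x∈C with onCycle? x
      ... | yes _  = refl
      ... | no x∉C = contradiction x∈C x∉C

      switch-partnerOnCycle : ∀ {x} → OnCycle (p x) → switch x ≡ step (p x)
      switch-partnerOnCycle {x} px∈C with onCycle? x | onCycle? (p x)
      ... | yes x∈C | _       = contradiction px∈C (partner-offCycle x∈C)
      ... | no _    | yes _   = refl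
      ... | no _    | no px∉C = contradiction px∈C px∉C

      switch-offCycle : ∀ {x} → ¬ OnCycle x → ¬ OnCycle (p x) → switch x ≡ p x
      switch-offCycle {x} x∉C px∉C with onCycle? x | onCycle? (p x)
      ... | yes x∈C | _        = contradiction x∈C x∉C
      ... | no _    | yes px∈C = contradiction px∈C px∉C
      ... | no _    | no _     = refl

      partner²-onCycle : ∀ {x} → OnCycle x → OnCycle (p (p x))
      partner²-onCycle = subst OnCycle (≡.sym (partner-involutive M _))

      switch-involutive : ∀ x → switch (switch x) ≡ x
      switch-involutive x = by-position (onCycle? x) (onCycle? (p x))
        where
        open ≡.≡-Reasoning
        by-position : Dec (OnCycle x) → Dec (OnCycle (p x)) → switch (switch x) ≡ x
        by-position (yes x∈C) _ = begin
          switch (switch x)      ≡⟨ cong switch (switch-onCycle x∈C) ⟩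
          switch (p (back x))    ≡⟨ switch-partnerOnCycle (partner²-onCycle (back-onCycle x∈C)) ⟩
          step (p (p (back x)))  ≡⟨ cong step (partner-involutive M (back x)) ⟩
          step (back x)          ≡⟨ step-back x∈C ⟩
          x                      ∎
        by-position (no x∉C) (yes px∈C) = begin
          switch (switch x)        ≡⟨ cong switch (switch-partnerOnCycle px∈C) ⟩
          switch (step (p x))      ≡⟨ switch-onCycle (step-onCycle px∈C) ⟩
          p (back (step (p x)))    ≡⟨ cong p (back-step px∈C) ⟩
          p (p x)                  ≡⟨ partner-involutive M x ⟩
          x                        ∎
        by-position (no x∉C) (no px∉C) = begin
          switch (switch x)  ≡⟨ cong switch (switch-offCycle x∉C px∉C) ⟩
          switch (p x)       ≡⟨ switch-offCycle px∉C (x∉C ∘ subst OnCycle (partner-involutive M x)) ⟩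
          p (p x)            ≡⟨ partner-involutive M x ⟩
          x                  ∎

      switch-adj : ∀ x → Adj G x (switch x)
      switch-adj x = by-position (onCycle? x) (onCycle? (p x))
        where
        by-position : Dec (OnCycle x) → Dec (OnCycle (p x)) → Adj G x (switch x)
        by-position (yes x∈C@((Rx , _) , _)) _ =
          subst (Adj G x) (≡.sym (switch-onCycle x∈C))
            (Adj-sym (subst (Adj G (p (back x))) (step-back x∈C) (step-adj (fold-preserves {P = R} step-R k Rx))))
        by-position (no _) (yes px∈C@((Rpx , _) , _)) =
          subst₂ (Adj G) (partner-involutive M x) (≡.sym (switch-partnerOnCycle px∈C)) (step-adj Rpx)
        by-position (no x∉C) (no px∉C) =
          subst (Adj G x) (≡.sym (switch-offCycle x∉C px∉C)) (partner-adj M x)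

      switched : PerfectMatching G
      switched = fromInvolution switch switch-involutive switch-adj

      switched-differs : ¬ SameMatching switched M
      switched-differs same = step-irreflexive Rw (begin
        step w         ≡⟨ cong step (partner-involutive M w) ⟨
        step (p (p w)) ≡⟨ switch-partnerOnCycle (partner²-onCycle ((Rw , refl) , w-periodic)) ⟨
        switch (p w)   ≡⟨ SameMatching⇒samePartner {M = switched} {M} same (p w) ⟩
        p (p w)        ≡⟨ partner-involutive M w ⟩
        w              ∎)
        where open ≡.≡-Reasoning

    another-matching : ∀ {u} → R u → ∃ λ M′ → ¬ SameMatching M′ M
    another-matching {u} Ru with periodic-point step u
    ... | i , k , periodic = switched {k = k} Rw periodic , switched-differs Rw periodic
      where
      Rw : R (fold u step i)
      Rw = fold-preserves {P = R} step-R i Ru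

  stable-∷ : ∀ {L v} → Stable G (setOf L) → (∀ {a} → a ∈ L → ¬ Adj G v a) → Stable G (setOf (v ∷ L))
  stable-∷ {L} {v} L-stable v≁L a b a∈ b∈ with ∈-setOf⁻ (v ∷ L) a∈ | ∈-setOf⁻ (v ∷ L) b∈
  ... | here refl | here refl = Adj-irrefl
  ... | here refl | there b∈L = v≁L b∈L
  ... | there a∈L | here refl = v≁L a∈L ∘ Adj-sym
  ... | there a∈L | there b∈L = L-stable a b (∈-setOf⁺ a∈L) (∈-setOf⁺ b∈L)

  module _ (M : PerfectMatching G) where

    open import Data.List.Membership.DecPropositional (_≟_ {m}) using (_∈?_)

    private
      p : Fin m → Fin m
      p = partner M

    -- v ∈ A ∪ p[A], stated through the involution p.
    Covered : List (Fin m) → Fin m → Set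
    Covered A v = v ∈ A ⊎ p v ∈ A

    Covered? : ∀ A v → Dec (Covered A v)
    Covered? A v = v ∈? A ⊎-dec p v ∈? A

    NeighboursMatchedInto : List (Fin m) → Fin m → Set
    NeighboursMatchedInto A x = ∀ {v} → Adj G x v → p v ∈ A

    matched-or-escaping : ∀ A x → NeighboursMatchedInto A x ⊎ ∃ λ v → Adj G x v × p v ∉ A
    matched-or-escaping A x with any? (λ v → Adj? x v ×-dec ¬? (p v ∈? A))
    ... | yes escaping = inj₂ escaping
    ... | no ∄         = inj₁ λ {v} xv → decidable-stable (p v ∈? A) λ pv∉A → ∄ (v , xv , pv∉A)

    Peelable : List (Fin m) → Fin m → Set
    Peelable L x = ¬ Covered L x × NeighboursMatchedInto (L ∷ʳ x) x

    peelable? : ∀ L x → Dec (Peelable L x)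
    peelable? L x with matched-or-escaping (L ∷ʳ x) x
    ... | inj₁ matched = map′ (_, matched) proj₁ (¬? (Covered? L x))
    ... | inj₂ (_ , xv , pv∉) = no λ (_ , matched) → pv∉ (matched xv)

    data Peeling : List (Fin m) → Set where
      []   : Peeling []
      snoc : ∀ {L x} → Peeling L → Peelable L x → Peeling (L ∷ʳ x)

    peeling-unique : ∀ {L} → Peeling L → Unique L
    peeling-unique []                 = []
    peeling-unique (snoc P (x∉L , _)) = ∷ʳ-unique⁺ (peeling-unique P) (x∉L ∘ inj₁)

    peeling-matched : ∀ {L} → Peeling L → ∀ {a} → a ∈ L → NeighboursMatchedInto L a
    peeling-matched (snoc {L} P (_ , x-matched)) a∈ with ∈-∷ʳ⁻ L a∈
    ... | inj₁ a∈L  = ∈-++⁺ˡ ∘ peeling-matched P a∈L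
    ... | inj₂ refl = x-matched

    peeling-stable : ∀ {L} → Peeling L → Stable G (setOf L)
    peeling-stable []                     _ _ a∈⊥ = contradiction a∈⊥ ∉⊥
    peeling-stable (snoc {L} P (x∉L , _)) a b a∈ b∈ with ∈-∷ʳ⁻ L (∈-setOf⁻ _ a∈) | ∈-∷ʳ⁻ L (∈-setOf⁻ _ b∈)
    ... | inj₁ a∈L  | inj₁ b∈L  = peeling-stable P a b (∈-setOf⁺ a∈L) (∈-setOf⁺ b∈L)
    ... | inj₁ a∈L  | inj₂ refl = x∉L ∘ inj₂ ∘ peeling-matched P a∈L
    ... | inj₂ refl | inj₁ b∈L  = x∉L ∘ inj₂ ∘ peeling-matched P b∈L ∘ Adj-sym
    ... | inj₂ refl | inj₂ refl = Adj-irrefl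

    peeling-take : ∀ {L} → Peeling L → ∀ j → Peeling (take j L)
    peeling-take []                          zero    = []
    peeling-take []                          (suc j) = []
    peeling-take (snoc {L} {x} P x-peelable) j with take-∷ʳ j L x
    ... | inj₁ eq = subst Peeling (≡.sym eq) (peeling-take P j)
    ... | inj₂ eq = subst Peeling (≡.sym eq) (snoc P x-peelable)

    ∣stable∣≤∣setOf∣ : ∀ {L S} → Unique L → Stable G S → (∀ {v} → v ∈ₛ S → Covered L v) → ∣ S ∣ ≤ ∣ setOf L ∣
    ∣stable∣≤∣setOf∣ {L} !L S-stable covered =
      subst (_ ≤_) (≡.sym (∣setOf∣≡length !L))
        (∣pairFree∣≤length (partner-involutive M) L covered λ v∈S pv∈S → S-stable _ _ v∈S pv∈S (partner-adj M _))

    peeling⇒LocalMaxStable : ∀ {L} → Peeling L → LocalMaxStable G (setOf L)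
    peeling⇒LocalMaxStable {L} P = (λ _ → inj₁) , peeling-stable P , λ S S⊆N[L] S-stable →
      ∣stable∣≤∣setOf∣ (peeling-unique P) S-stable (closedNeighbourhood-covered ∘ S⊆N[L] _)
      where
      closedNeighbourhood-covered : ∀ {v} → InClosedN G (setOf L) v → Covered L v
      closedNeighbourhood-covered (inj₁ v∈L)                 = inj₁ (∈-setOf⁻ L v∈L)
      closedNeighbourhood-covered (inj₂ (_ , _ , u∈L , vu)) = inj₂ (peeling-matched P (∈-setOf⁻ L u∈L) (Adj-sym vu))

    peeling⇒MaximumStable : ∀ {L} → Peeling L → (∀ v → Covered L v) → MaximumStable G (setOf L)
    peeling⇒MaximumStable P covers =
      peeling-stable P , λ S S-stable → ∣stable∣≤∣setOf∣ (peeling-unique P) S-stable (λ {v} _ → covers v)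

    peeling⇒AccessibilityChain : ∀ {L} → Peeling L → AccessibilityChain G (setOf L) L
    peeling⇒AccessibilityChain {L} P =
      peeling-unique P , (λ v → mk⇔ (∈-setOf⁻ L) ∈-setOf⁺) , λ j _ _ → peeling⇒LocalMaxStable (peeling-take P j)

    partner-agrees-on-peeling : ∀ {L} → Peeling L → (M′ : PerfectMatching G) → ∀ {x} → x ∈ L → partner M′ x ≡ p x
    partner-agrees-on-peeling (snoc {L} {x} P (x∉L , x-matched)) M′ y∈ with ∈-∷ʳ⁻ L y∈
    ... | inj₁ y∈L  = partner-agrees-on-peeling P M′ y∈L
    ... | inj₂ refl with ∈-∷ʳ⁻ L (x-matched (partner-adj M′ x))
    ...   | inj₂ p[q[x]]≡x = trans (≡.sym (partner-involutive M (partner M′ x))) (cong p p[q[x]]≡x)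
    ...   | inj₁ p[q[x]]∈L = contradiction (inj₁ (subst (_∈ L) p[q[x]]≡x p[q[x]]∈L)) x∉L
      where
      p[q[x]]≡x : p (partner M′ x) ≡ x
      p[q[x]]≡x = partner-injective M′
        (trans (partner-agrees-on-peeling P M′ p[q[x]]∈L) (partner-involutive M (partner M′ x)))

    covering-peeling⇒UniquePM : ∀ {L} → Peeling L → (∀ v → Covered L v) → UniquePM M
    covering-peeling⇒UniquePM {L} P covers M′ = samePartner⇒SameMatching {M′} {M} (agree ∘ covers)
      where
      open ≡.≡-Reasoning
      agree : ∀ {v} → Covered L v → partner M′ v ≡ p v
      agree (inj₁ v∈L)      = partner-agrees-on-peeling P M′ v∈L
      agree {v} (inj₂ pv∈L) = begin
        partner M′ v                  ≡⟨ cong (partner M′) q[pv]≡v ⟨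
        partner M′ (partner M′ (p v)) ≡⟨ partner-involutive M′ (p v) ⟩
        p v                           ∎
        where
        q[pv]≡v : partner M′ (p v) ≡ v
        q[pv]≡v = trans (partner-agrees-on-peeling P M′ pv∈L) (partner-involutive M v)

    maximum-peeling-covers : ∀ {L} → Peeling L → MaximumStable G (setOf L) → ∀ v → Covered L v
    maximum-peeling-covers {L} P (_ , maximum) v = decidable-stable (Covered? L v) λ v-uncovered →
      <⇒≱ (larger v-uncovered) (maximum (setOf (v ∷ L)) (stable-∷ (peeling-stable P) (v≁L v-uncovered)))
      where
      v≁L : ¬ Covered L v → ∀ {a} → a ∈ L → ¬ Adj G v a
      v≁L v-uncovered a∈L = v-uncovered ∘ inj₂ ∘ peeling-matched P a∈L ∘ Adj-sym
      larger : ¬ Covered L v → ∣ setOf L ∣ < ∣ setOf (v ∷ L) ∣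
      larger v-uncovered = ≤-reflexive (≡.sym (x∉p⇒∣⁅x⁆∪p∣≡1+∣p∣ (setOf L) (v-uncovered ∘ inj₁ ∘ ∈-setOf⁻ L)))

    module _ (bip : Bipartite G) where

      escaping-neighbour⇒¬LocalMaxStable : ∀ {L x v} → Peeling L → x ∉ L → Adj G x v → p v ∉ L ∷ʳ x →
                                          ¬ LocalMaxStable G (setOf (L ∷ʳ x))
      escaping-neighbour⇒¬LocalMaxStable {L} {x} {v} P x∉L xv pv∉ (_ , stable , maximal) =
        <⇒≱ larger (maximal S S⊆N[L∷ʳx] S-stable)
        where
        S : Subset m
        S = setOf (p x ∷ v ∷ L)
        x∈ : x ∈ₛ setOf (L ∷ʳ x)
        x∈ = ∈-setOf⁺ (∈-++⁺ʳ L (here refl))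
        neighbour∉ : ∀ {u} → Adj G x u → u ∉ₛ setOf (L ∷ʳ x)
        neighbour∉ xu u∈ = stable _ _ x∈ u∈ xu
        px≢v : p x ≢ v
        px≢v px≡v = pv∉ (∈-++⁺ʳ L (here (trans (cong p (≡.sym px≡v)) (partner-involutive M x))))
        S-unique : Unique (p x ∷ v ∷ L)
        S-unique = (px≢v ∷ ¬Any⇒All¬ L (neighbour∉ (partner-adj M x) ∘ ∈-setOf⁺ ∘ ∈-++⁺ˡ))
                 ∷ ¬Any⇒All¬ L (neighbour∉ xv ∘ ∈-setOf⁺ ∘ ∈-++⁺ˡ)
                 ∷ peeling-unique P
        v≁L : ∀ {a} → a ∈ L → ¬ Adj G v a
        v≁L a∈L = pv∉ ∘ ∈-++⁺ˡ ∘ peeling-matched P a∈L ∘ Adj-sym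
        px≁ : ∀ {a} → a ∈ v ∷ L → ¬ Adj G (p x) a
        px≁ (here refl)  = common-neighbours-nonadjacent bip (partner-adj M x) xv
        px≁ (there a∈L) = x∉L ∘ subst (_∈ L) (partner-involutive M x) ∘ peeling-matched P a∈L ∘ Adj-sym
        S-stable : Stable G S
        S-stable = stable-∷ (stable-∷ (peeling-stable P) v≁L) px≁
        S⊆N[L∷ʳx] : ∀ u → u ∈ₛ S → InClosedN G (setOf (L ∷ʳ x)) u
        S⊆N[L∷ʳx] u u∈ with ∈-setOf⁻ (p x ∷ v ∷ L) u∈
        ... | here refl         = inj₂ (neighbour∉ (partner-adj M x) , x , x∈ , Adj-sym (partner-adj M x))
        ... | there (here refl) = inj₂ (neighbour∉ xv , x , x∈ , Adj-sym xv)
        ... | there (there u∈L) = inj₁ (∈-setOf⁺ (∈-++⁺ˡ u∈L))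
        larger : ∣ setOf (L ∷ʳ x) ∣ < ∣ S ∣
        larger = begin-strict
          ∣ setOf (L ∷ʳ x) ∣   ≡⟨ ∣setOf∣≡length (∷ʳ-unique⁺ (peeling-unique P) x∉L) ⟩
          length (L ∷ʳ x)      ≡⟨ length-∷ʳ L x ⟩
          suc (length L)       <⟨ n<1+n _ ⟩
          length (p x ∷ v ∷ L) ≡⟨ ∣setOf∣≡length S-unique ⟨
          ∣ S ∣                ∎
          where open ≤-Reasoning

      LocalMaxStable-∷ʳ⇒peelable : ∀ {L x} → Peeling L → x ∉ L → LocalMaxStable G (setOf (L ∷ʳ x)) → Peelable L x
      LocalMaxStable-∷ʳ⇒peelable {L} {x} P x∉L L∷ʳx-local@(_ , stable , _) = [ x∉L , px∉L ] , x-matched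
        where
        px∉L : p x ∉ L
        px∉L px∈L = stable _ _ (∈-setOf⁺ (∈-++⁺ʳ L (here refl))) (∈-setOf⁺ (∈-++⁺ˡ px∈L)) (partner-adj M x)
        x-matched : NeighboursMatchedInto (L ∷ʳ x) x
        x-matched {v} xv = decidable-stable (p v ∈? L ∷ʳ x) λ pv∉ →
          escaping-neighbour⇒¬LocalMaxStable P x∉L xv pv∉ L∷ʳx-local

      AccessibilityChain⇒Peeling : ∀ {S xs} → AccessibilityChain G S xs → Peeling xs
      AccessibilityChain⇒Peeling {S} {xs} (!xs , _ , local) =
        subst Peeling (take-all _ xs ≤-refl) (prefix (length xs) ≤-refl)
        where
        prefix : ∀ j → j ≤ length xs → Peeling (take j xs)
        prefix zero    _     = []
        prefix (suc j) j<len with take-suc-∷ʳ xs j<len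
        ... | x , eq = subst Peeling (≡.sym eq) (snoc P (LocalMaxStable-∷ʳ⇒peelable P x∉ x-local))
          where
          P : Peeling (take j xs)
          P = prefix j (<⇒≤ j<len)
          x∉ : x ∉ take j xs
          x∉ = ∷ʳ-unique⁻ (take j xs) (subst Unique eq (Unique.take⁺ (suc j) !xs))
          x-local : LocalMaxStable G (setOf (take j xs ∷ʳ x))
          x-local = subst (LocalMaxStable G ∘ setOf) eq (local (suc j) (s≤s z≤n) j<len)

      AccessibilityChain⇒UniquePM : ∀ {S xs} → MaximumStable G S → AccessibilityChain G S xs → UniquePM M
      AccessibilityChain⇒UniquePM {S} {xs} S-maximum chain@(_ , S⇔xs , _) =
        covering-peeling⇒UniquePM P (maximum-peeling-covers P (subst (MaximumStable G) S≡xs S-maximum))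
        where
        P : Peeling xs
        P = AccessibilityChain⇒Peeling chain
        S≡xs : S ≡ setOf xs
        S≡xs = ⊆-antisym (∈-setOf⁺ ∘ to (S⇔xs _)) (from (S⇔xs _) ∘ ∈-setOf⁻ xs)

      peelable-exists : UniquePM M → ∀ {L u} → Peeling L → ¬ Covered L u → ∃ (Peelable L)
      peelable-exists M-unique {L} P u-uncovered with any? (peelable? L)
      ... | yes found = found
      ... | no none   = let M′ , M′≢M = another-matching u-uncovered in contradiction (M-unique M′) M′≢M
        where
        R-partner : ∀ {v} → ¬ Covered L v → ¬ Covered L (p v)
        R-partner v-uncovered = v-uncovered ∘ [ inj₂ , inj₁ ∘ subst (_∈ L) (partner-involutive M _) ]
        R-branch : ∀ {v} → ¬ Covered L v → ∃ λ w → ¬ Covered L w × Adj G v w × w ≢ p v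
        R-branch {v} v-uncovered with matched-or-escaping (L ∷ʳ v) v
        ... | inj₁ v-matched      = contradiction (v , v-uncovered , λ {_} → v-matched) none
        ... | inj₂ (w , vw , pw∉) = w , [ w∉L , pw∉ ∘ ∈-++⁺ˡ ] , vw , w≢pv
          where
          w∉L : w ∉ L
          w∉L w∈L = v-uncovered (inj₂ (peeling-matched P w∈L (Adj-sym vw)))
          w≢pv : w ≢ p v
          w≢pv refl = pw∉ (∈-++⁺ʳ L (here (partner-involutive M v)))
        open AlternatingCycle bip M (λ v → ¬? (Covered? L v)) R-partner R-branch

      extend-to-covering : UniquePM M → ∀ n {L} → Peeling L → length L + n ≡ m →
                           ∃ λ xs → Peeling xs × (∀ v → Covered xs v)
      extend-to-covering M-unique zero {L} P len≡m = L , P , λ v → inj₁ (∈-setOf⁻ L (subst (v ∈ₛ_) (≡.sym L-full) ∈⊤))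
        where
        L-full : setOf L ≡ ⊤
        L-full = ∣p∣≡n⇒p≡⊤ (trans (∣setOf∣≡length (peeling-unique P)) (trans (≡.sym (+-identityʳ _)) len≡m))
      extend-to-covering M-unique (suc n) {L} P len≡m with all? (Covered? L)
      ... | yes covers = L , P , covers
      ... | no ¬covers with ¬∀⟶∃¬ m _ (Covered? L) ¬covers
      ...   | u , u-uncovered with peelable-exists M-unique P u-uncovered
      ...     | x , x-peelable =
        extend-to-covering M-unique n (snoc P x-peelable)
          (trans (cong (_+ n) (length-∷ʳ L x)) (trans (≡.sym (+-suc _ n)) len≡m))

      UniquePM⇒AccessibilityChain : UniquePM M → Σ (Subset m) λ S → MaximumStable G S × HasAccessibilityChain G S
      UniquePM⇒AccessibilityChain M-unique with extend-to-covering M-unique m [] refl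
      ... | xs , P , covers = setOf xs , peeling⇒MaximumStable P covers , xs , peeling⇒AccessibilityChain P

proposition2 : (n : ℕ) (G : Graph (2 * n)) → Bipartite G → (M : PerfectMatching G) →
    UniquePM M ⇔ Σ (Subset (2 * n)) (λ S → MaximumStable G S × HasAccessibilityChain G S)
proposition2 n G bip M = mk⇔ (UniquePM⇒AccessibilityChain M bip)
  λ (_ , S-maximum , _ , chain) → AccessibilityChain⇒UniquePM M bip S-maximum chain
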